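{- Let $S\subseteq X$ be a non-empty generalised nice set, and put $I_S=\{a,b,a*b:\{a,b\}\in S\}$ and $J_S=\{a*b:\{a,b\}\in S\}$. Then: (a) for pairwise distinct $i,j,k,l\in I$, the set $S\cup\{\{i,i\},\{j,j\},\{k,k\},\{l,l\}\}$ is a generalised nice set if and only if $\{i,j,k,l\}\cap J_S=\emptyset$; (b) for generative $i,j,k\in I$, the set $S\cup\{\{0,0\},\{0,i\},\{0,j\},\{0,k\}\}$ is a generalised nice set if and only if $\{i,j,k\}\cap I_S=\emptyset$, and in that case $|S|=1$; (c) for distinct $i,j\in I$, the set $S\cup\{\{0,0\},\{0,i\},\{0,j\},\{0,i*j\}\}$ is a generalised nice set if and only if $\{i,j,i*j\}=I_S$, and in that case $|S|=1$.
   Context: Let $I=\{1,\dots,7\}$ and $I_0=I\cup\{0\}$. The Fano plane on $I$ has the seven lines $\{1,2,5\},\{5,6,7\},\{1,4,7\},\{1,3,6\},\{2,4,6\},\{2,3,7\},\{3,4,5\}$. For distinct $i,j\in I$, $i*j$ is the third point of the unique line containing $i$ and $j$. The operation is extended to $I_0$ by $0*i=i*0=i$ and $i*i=0$ for all $i\in I_0$. Three pairwise distinct $i,j,k\in I$ are generative if $k\neq i*j$. Let $X_0$ be the set of unordered pairs $\{i,j\}$ with $i,j\in I_0$, where $i=j$ is allowed, and $X=\{\{i,j\}:i,j\in I,\ i\neq j\}$. For $i,j,k\in I_0$ let $P_{\{i,j,k\}}=\{\{i,j\},\{j,k\},\{k,i\},\{i,j*k\},\{j,k*i\},\{k,i*j\}\}\subseteq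 X_0$. A subset $T\subseteq X_0$ is a generalised nice set if for all $i,j,k\in I_0$, $\{i,j\}\in T$ and $\{i*j,k\}\in T$ imply $P_{\{i,j,k\}}\subseteq T$. -}

module Defs where

open import Data.Fin using (Fin; zero; suc; #_)
open import Data.Fin.Properties using (_≟_)
open import Data.Nat using (ℕ)
open import Data.Product using (_×_; _,_; ∃; ∃-syntax; Σ)
open import Data.Sum using (_⊎_)
open import Data.List using (List; []; _∷_)
open import Data.Maybe using (Maybe; just; nothing)
open import Relation.Nullary using (¬_; yes; no)
open import Relation.Nullary.Decidable using (⌊_⌋)
open import Data.Bool using (Bool; true; false; _∧_; _∨_; if_then_else_)
open import Relation.Binary.PropositionalEquality using (_≡_; _≢_)
open import Function.Bundles using (_⇔_)

-- I₀ = {0,…,7} is Fin 8; the point 0 is `zero`, I = nonzero elements.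
Pt : Set
Pt = Fin 8

𝟘 : Pt
𝟘 = zero

fanoLines : List (Pt × Pt × Pt)
fanoLines =
  (# 1 , # 2 , # 5) ∷ (# 5 , # 6 , # 7) ∷ (# 1 , # 4 , # 7) ∷ (# 1 , # 3 , # 6) ∷
  (# 2 , # 4 , # 6) ∷ (# 2 , # 3 , # 7) ∷ (# 3 , # 4 , # 5) ∷ []

private
  _==_ : Pt → Pt → Bool
  x == y = ⌊ x ≟ y ⌋

  samePair : Pt → Pt → Pt → Pt → Bool
  samePair i j x y = ((i == x) ∧ (j == y)) ∨ ((i == y) ∧ (j == x))

  thirdOn : Pt → Pt → Pt × Pt × Pt → Maybe Pt
  thirdOn i j (a , b , c) =
    if samePair i j a b then just c
    else if samePair i j a c then just b
    else if samePair i j b c then just a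
    else nothing

  thirdIn : Pt → Pt → List (Pt × Pt × Pt) → Pt
  thirdIn i j [] = zero
  thirdIn i j (l ∷ ls) with thirdOn i j l
  ... | just c = c
  ... | nothing = thirdIn i j ls

_*_ : Pt → Pt → Pt
i * j with i ≟ j
... | yes _ = zero
... | no _ with i ≟ zero | j ≟ zero
...   | yes _ | _ = j
...   | no _ | yes _ = i
...   | no _ | no _ = thirdIn i j fanoLines

infixl 7 _*_

-- A subset of X₀ (unordered pairs, i = j allowed) is represented by a
-- predicate R on ordered pairs; the unordered pair {i,j} belongs to it iff
-- R i j or R j i.
PairSet : Set₁
PairSet = Pt → Pt → Set

_∈ₚ_ : Pt × Pt → PairSet → Set
(i , j) ∈ₚ T = T i j ⊎ T j i

infix 4 _∈ₚ_

⊆X : PairSet → Set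
⊆X S = ∀ i j → (i , j) ∈ₚ S → i ≢ 𝟘 × j ≢ 𝟘 × i ≢ j

NonEmpty : PairSet → Set
NonEmpty S = ∃[ a ] ∃[ b ] (a , b) ∈ₚ S

CardOne : PairSet → Set
CardOne S = ∃[ a ] ∃[ b ] (∀ x y → ((x , y) ∈ₚ S ⇔ ((x ≡ a × y ≡ b) ⊎ (x ≡ b × y ≡ a))))

P⊆ : Pt → Pt → Pt → PairSet → Set
P⊆ i j k T =
  (i , j) ∈ₚ T × (j , k) ∈ₚ T × (k , i) ∈ₚ T ×
  (i , j * k) ∈ₚ T × (j , k * i) ∈ₚ T × (k , i * j) ∈ₚ T

GenNice : PairSet → Set
GenNice T = ∀ i j k → (i , j) ∈ₚ T → (i * j , k) ∈ₚ T → P⊆ i j k T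

_∪₄_ : PairSet → (Pt × Pt) × (Pt × Pt) × (Pt × Pt) × (Pt × Pt) → PairSet
(S ∪₄ (p₁ , p₂ , p₃ , p₄)) x y =
  S x y ⊎ (x , y) ≡ p₁ ⊎ (x , y) ≡ p₂ ⊎ (x , y) ≡ p₃ ⊎ (x , y) ≡ p₄

_∈I_ : Pt → PairSet → Set
x ∈I S = ∃[ a ] ∃[ b ] ((a , b) ∈ₚ S × (x ≡ a ⊎ x ≡ b ⊎ x ≡ a * b))

_∈J_ : Pt → PairSet → Set
x ∈J S = ∃[ a ] ∃[ b ] ((a , b) ∈ₚ S × x ≡ a * b)

Distinct4 : Pt → Pt → Pt → Pt → Set
Distinct4 i j k l = i ≢ j × i ≢ k × i ≢ l × j ≢ k × j ≢ l × k ≢ l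

InI : Pt → Set
InI i = i ≢ 𝟘

Generative : Pt → Pt → Pt → Set
Generative i j k = InI i × InI j × InI k × i ≢ j × j ≢ k × i ≢ k × k ≢ i * j

{-# OPTIONS --safe #-}
-- Write line a b = {a, b, a * b}: (I₀, *) is the group (ℤ/2)³ and these are the lines of the
-- Fano plane. (a) If a diagonal point is a * b for {a, b} ∈ S, niceness applied to {a, b} and
-- {a * b, a * b} puts {a * b, a} into the extension, which is impossible. (b), (c) Adding
-- {0,0}, {0,p}, {0,q}, {0,r} preserves niceness exactly when every line of a pair of S that
-- meets {p, q, r} lies inside it. A generative triple contains no line, so in (b) this says
-- that I_S misses the triple; any two lines meet, so in (c) it says that every pair of S
-- spans the line {i, j, i * j}. Either way all pairs of S span one common line (in (b) the
-- line through i * j and i * k), and a line carries only one pair of S, since {a, a * b} ∈ S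
-- would force {a, a} ∈ S by niceness with {a, b}.
module Submission where

open import Defs
open import Data.Product using (_×_; _,_; proj₁; proj₂; ∃-syntax)
open import Relation.Nullary using (¬_; ¬?; Dec; yes; no)
open import Relation.Binary.PropositionalEquality
  using (_≡_; _≢_; refl; sym; trans; subst; cong; module ≡-Reasoning)
open import Data.Sum using (_⊎_; inj₁; inj₂)
open import Function.Bundles using (_⇔_; mk⇔; Equivalence)
import Function.Properties.Equivalence as ⇔
open import Data.Empty using (⊥; ⊥-elim)
open import Function.Base using (_∘_)
open import Data.Fin.Properties using (_≟_; all?; any?)
open import Relation.Nullary.Decidable using (toWitness; _→-dec_; _×-dec_; _⊎-dec_)

Proper : Pt → Pt → Set
Proper a b = a ≢ 𝟘 × b ≢ 𝟘 × a ≢ b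

proper? : ∀ a b → Dec (Proper a b)
proper? a b = ¬? (a ≟ 𝟘) ×-dec ¬? (b ≟ 𝟘) ×-dec ¬? (a ≟ b)

Triple : Set
Triple = Pt × Pt × Pt

infix 4 _∈₃_ _∈₃?_ _⊆₃_ _meets_

_∈₃_ : Pt → Triple → Set
x ∈₃ (p , q , r) = x ≡ p ⊎ x ≡ q ⊎ x ≡ r

_∈₃?_ : ∀ x t → Dec (x ∈₃ t)
x ∈₃? (p , q , r) = x ≟ p ⊎-dec x ≟ q ⊎-dec x ≟ r

_⊆₃_ : Triple → Triple → Set
(p , q , r) ⊆₃ t = p ∈₃ t × q ∈₃ t × r ∈₃ t

_meets_ : Triple → Triple → Set
s meets t = ∃[ x ] x ∈₃ s × x ∈₃ t

Distinct₃ : Triple → Set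
Distinct₃ (p , q , r) = p ≢ q × p ≢ r × q ≢ r

line : Pt → Pt → Triple
line a b = a , b , a * b

-- `abstract` stops these exhaustively checked facts from being unfolded, and their
-- decision procedures re-run, when a use site is normalised (for example under `with`).
abstract
  *-identityˡ : ∀ x → 𝟘 * x ≡ x
  *-identityˡ = toWitness {a? = all? λ x → 𝟘 * x ≟ x} _

  *-selfInverse : ∀ x → x * x ≡ 𝟘
  *-selfInverse = toWitness {a? = all? λ x → x * x ≟ 𝟘} _

  *-comm : ∀ x y → x * y ≡ y * x
  *-comm = toWitness {a? = all? λ x → all? λ y → x * y ≟ y * x} _

  *-assoc : ∀ x y z → x * y * z ≡ x * (y * z)
  *-assoc = toWitness {a? = all? λ x → all? λ y → all? λ z → x * y * z ≟ x * (y * z)} _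

  lines-meet : ∀ {a b c d} → Proper a b → Proper c d → line a b meets line c d
  lines-meet {a} {b} {c} {d} = toWitness {a? = all? λ a → all? λ b → all? λ c → all? λ d →
    proper? a b →-dec proper? c d →-dec any? λ x → x ∈₃? line a b ×-dec x ∈₃? line c d} _ a b c d

  line-closed : ∀ {x y c d} → x ≢ y → x ∈₃ line c d → y ∈₃ line c d → x * y ∈₃ line c d
  line-closed {x} {y} {c} {d} = toWitness {a? = all? λ x → all? λ y → all? λ c → all? λ d →
    ¬? (x ≟ y) →-dec x ∈₃? line c d →-dec y ∈₃? line c d →-dec x * y ∈₃? line c d} _ x y c d

*-identityʳ : ∀ x → x * 𝟘 ≡ x
*-identityʳ x = trans (*-comm x 𝟘) (*-identityˡ x)

x*[x*y]≡y : ∀ x y → x * (x * y) ≡ y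
x*[x*y]≡y x y = begin
  x * (x * y)  ≡⟨ sym (*-assoc x x y) ⟩
  x * x * y    ≡⟨ cong (_* y) (*-selfInverse x) ⟩
  𝟘 * y        ≡⟨ *-identityˡ y ⟩
  y            ∎
  where open ≡-Reasoning

*-cancelˡ : ∀ x {y z} → x * y ≡ x * z → y ≡ z
*-cancelˡ x {y} {z} eq = trans (sym (x*[x*y]≡y x y)) (trans (cong (x *_) eq) (x*[x*y]≡y x z))

*≡𝟘⇒≡ : ∀ {x y} → x * y ≡ 𝟘 → x ≡ y
*≡𝟘⇒≡ {x} eq = *-cancelˡ x (trans (*-selfInverse x) (sym eq))

*≡ˡ⇒𝟘 : ∀ {x y} → x * y ≡ x → y ≡ 𝟘
*≡ˡ⇒𝟘 {x} eq = *-cancelˡ x (trans eq (sym (*-identityʳ x)))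

*≡ʳ⇒𝟘 : ∀ {x y} → x * y ≡ y → x ≡ 𝟘
*≡ʳ⇒𝟘 {x} {y} eq = *≡ˡ⇒𝟘 (trans (*-comm y x) eq)

∈₃-⊆₃ : ∀ {x s t} → x ∈₃ s → s ⊆₃ t → x ∈₃ t
∈₃-⊆₃ (inj₁ refl) (p∈ , _ , _) = p∈
∈₃-⊆₃ (inj₂ (inj₁ refl)) (_ , q∈ , _) = q∈
∈₃-⊆₃ (inj₂ (inj₂ refl)) (_ , _ , r∈) = r∈

⊆₃-trans : ∀ {s t u} → s ⊆₃ t → t ⊆₃ u → s ⊆₃ u
⊆₃-trans (p∈ , q∈ , r∈) t⊆u = ∈₃-⊆₃ p∈ t⊆u , ∈₃-⊆₃ q∈ t⊆u , ∈₃-⊆₃ r∈ t⊆u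

private
  ∈₃-rotate : ∀ {x u v w} → x ∈₃ (u , v , w) → x ∈₃ (v , w , u)
  ∈₃-rotate (inj₁ x≡u) = inj₂ (inj₂ x≡u)
  ∈₃-rotate (inj₂ (inj₁ x≡v)) = inj₁ x≡v
  ∈₃-rotate (inj₂ (inj₂ x≡w)) = inj₂ (inj₁ x≡w)

  ⊆₃-rotate : ∀ {s u v w} → s ⊆₃ (u , v , w) → s ⊆₃ (v , w , u)
  ⊆₃-rotate (p∈ , q∈ , r∈) = ∈₃-rotate p∈ , ∈₃-rotate q∈ , ∈₃-rotate r∈

  pigeonhole₃₂ : ∀ {p q r v w : Pt} → Distinct₃ (p , q , r) →
                 p ≡ v ⊎ p ≡ w → q ≡ v ⊎ q ≡ w → r ≡ v ⊎ r ≡ w → ⊥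
  pigeonhole₃₂ (p≢q , _ , _) (inj₁ refl) (inj₁ refl) _ = p≢q refl
  pigeonhole₃₂ (p≢q , _ , _) (inj₂ refl) (inj₂ refl) _ = p≢q refl
  pigeonhole₃₂ (_ , p≢r , _) (inj₁ refl) _ (inj₁ refl) = p≢r refl
  pigeonhole₃₂ (_ , p≢r , _) (inj₂ refl) _ (inj₂ refl) = p≢r refl
  pigeonhole₃₂ (_ , _ , q≢r) _ (inj₁ refl) (inj₁ refl) = q≢r refl
  pigeonhole₃₂ (_ , _ , q≢r) _ (inj₂ refl) (inj₂ refl) = q≢r refl

  first-covered : ∀ {s u v w} → Distinct₃ s → s ⊆₃ (u , v , w) → u ∈₃ s
  first-covered {p , q , r} {u} d (p∈ , q∈ , r∈) with p ≟ u | q ≟ u | r ≟ u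
  ... | yes p≡u | _ | _ = inj₁ (sym p≡u)
  ... | _ | yes q≡u | _ = inj₂ (inj₁ (sym q≡u))
  ... | _ | _ | yes r≡u = inj₂ (inj₂ (sym r≡u))
  ... | no p≢u | no q≢u | no r≢u = ⊥-elim (pigeonhole₃₂ d (off p∈ p≢u) (off q∈ q≢u) (off r∈ r≢u))
    where
    off : ∀ {x v w} → x ∈₃ (u , v , w) → x ≢ u → x ≡ v ⊎ x ≡ w
    off (inj₁ x≡u) x≢u = ⊥-elim (x≢u x≡u)
    off (inj₂ x∈vw) _ = x∈vw

⊆₃-pigeonhole : ∀ {s t} → Distinct₃ s → s ⊆₃ t → t ⊆₃ s
⊆₃-pigeonhole d s⊆t =
  first-covered d s⊆t , first-covered d (⊆₃-rotate s⊆t) , first-covered d (⊆₃-rotate (⊆₃-rotate s⊆t))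

line-distinct : ∀ {a b} → Proper a b → Distinct₃ (line a b)
line-distinct (a≢𝟘 , b≢𝟘 , a≢b) =
  a≢b , (λ a≡ab → b≢𝟘 (*≡ˡ⇒𝟘 (sym a≡ab))) , λ b≡ab → a≢𝟘 (*≡ʳ⇒𝟘 (sym b≡ab))

line-spanned : ∀ {x y c d} → Proper x y → x ∈₃ line c d → y ∈₃ line c d → line c d ⊆₃ line x y
line-spanned pxy@(_ , _ , x≢y) x∈ y∈ =
  ⊆₃-pigeonhole (line-distinct pxy) (x∈ , y∈ , line-closed x≢y x∈ y∈)

generative⇒*∉ : ∀ {i j k} → Generative i j k → ¬ i * j ∈₃ (i , j , k)
generative⇒*∉ (_ , j≢𝟘 , _ , _ , _ , _ , _) (inj₁ ij≡i) = j≢𝟘 (*≡ˡ⇒𝟘 ij≡i)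
generative⇒*∉ (i≢𝟘 , _ , _ , _ , _ , _ , _) (inj₂ (inj₁ ij≡j)) = i≢𝟘 (*≡ʳ⇒𝟘 ij≡j)
generative⇒*∉ (_ , _ , _ , _ , _ , _ , k≢ij) (inj₂ (inj₂ ij≡k)) = k≢ij (sym ij≡k)

generative-lineFree : ∀ {i j k a b} → Generative i j k → Proper a b → ¬ line a b ⊆₃ (i , j , k)
generative-lineFree gen@(_ , _ , _ , i≢j , _ , _ , _) pab ab⊆ijk =
  let (i∈ , j∈ , _) = ⊆₃-pigeonhole (line-distinct pab) ab⊆ijk
  in generative⇒*∉ gen (∈₃-⊆₃ (line-closed i≢j i∈ j∈) ab⊆ijk)

∈ₚ-sym : ∀ (T : PairSet) {x y} → (x , y) ∈ₚ T → (y , x) ∈ₚ T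
∈ₚ-sym _ (inj₁ t) = inj₂ t
∈ₚ-sym _ (inj₂ t) = inj₁ t

∈ₚ-respˡ : ∀ (T : PairSet) {x x′ y} → x ≡ x′ → (x , y) ∈ₚ T → (x′ , y) ∈ₚ T
∈ₚ-respˡ _ refl t = t

∈ₚ-respʳ : ∀ (T : PairSet) {x y y′} → y ≡ y′ → (x , y) ∈ₚ T → (x , y′) ∈ₚ T
∈ₚ-respʳ _ refl t = t

P⊆-mono : ∀ (S T : PairSet) {x y z} →
          (∀ {a b} → (a , b) ∈ₚ S → (a , b) ∈ₚ T) → P⊆ x y z S → P⊆ x y z T
P⊆-mono _ _ S⊆T (xy , yz , zx , x[yz] , y[zx] , z[xy]) =
  S⊆T xy , S⊆T yz , S⊆T zx , S⊆T x[yz] , S⊆T y[zx] , S⊆T z[xy]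

P⊆-rotate : ∀ (T : PairSet) {x y z} → P⊆ x y z T → P⊆ y z x T
P⊆-rotate _ (xy , yz , zx , x[yz] , y[zx] , z[xy]) = yz , zx , xy , y[zx] , z[xy] , x[yz]

P⊆-swap : ∀ (T : PairSet) {x y z} → P⊆ x y z T → P⊆ y x z T
P⊆-swap T {x} {y} {z} (xy , yz , zx , x[yz] , y[zx] , z[xy]) =
  ∈ₚ-sym T xy , ∈ₚ-sym T zx , ∈ₚ-sym T yz ,
  ∈ₚ-respʳ T (*-comm z x) y[zx] , ∈ₚ-respʳ T (*-comm y z) x[yz] , ∈ₚ-respʳ T (*-comm x y) z[xy]

∪₄-inj₁ : ∀ (S : PairSet) {ps x y} → (x , y) ∈ₚ S → (x , y) ∈ₚ (S ∪₄ ps)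
∪₄-inj₁ _ (inj₁ s) = inj₁ (inj₁ s)
∪₄-inj₁ _ (inj₂ s) = inj₂ (inj₁ s)

AllOrNone : Triple → PairSet → Set
AllOrNone t S = ∀ {a b} → (a , b) ∈ₚ S → line a b meets t → line a b ⊆₃ t

module _ {S : PairSet} (S⊆X : ⊆X S) where

  private
    proper : ∀ {a b} → (a , b) ∈ₚ S → Proper a b
    proper {a} {b} = S⊆X a b

    irrefl : ∀ {a} → ¬ (a , a) ∈ₚ S
    irrefl aa∈ = proj₂ (proj₂ (proper aa∈)) refl

  allOrNone⇔∉I : ∀ {i j k} → Generative i j k →
                  AllOrNone (i , j , k) S ⇔ (¬ i ∈I S × ¬ j ∈I S × ¬ k ∈I S)
  allOrNone⇔∉I {i} {j} {k} gen = mk⇔ all∉I ∉I⇒allOrNone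
    where
    ∉I : AllOrNone (i , j , k) S → ∀ {x} → x ∈₃ (i , j , k) → ¬ x ∈I S
    ∉I allOrNone x∈ (a , b , ab∈ , x∈ab) =
      generative-lineFree gen (proper ab∈) (allOrNone ab∈ (_ , x∈ab , x∈))

    all∉I : AllOrNone (i , j , k) S → ¬ i ∈I S × ¬ j ∈I S × ¬ k ∈I S
    all∉I allOrNone =
      ∉I allOrNone (inj₁ refl) , ∉I allOrNone (inj₂ (inj₁ refl)) , ∉I allOrNone (inj₂ (inj₂ refl))

    ∉I⇒allOrNone : ¬ i ∈I S × ¬ j ∈I S × ¬ k ∈I S → AllOrNone (i , j , k) S
    ∉I⇒allOrNone (i∉ , _ , _) ab∈ (_ , x∈ , inj₁ refl) = ⊥-elim (i∉ (_ , _ , ab∈ , x∈))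
    ∉I⇒allOrNone (_ , j∉ , _) ab∈ (_ , x∈ , inj₂ (inj₁ refl)) = ⊥-elim (j∉ (_ , _ , ab∈ , x∈))
    ∉I⇒allOrNone (_ , _ , k∉) ab∈ (_ , x∈ , inj₂ (inj₂ refl)) = ⊥-elim (k∉ (_ , _ , ab∈ , x∈))

  ∉I⇒*∈line : ∀ {i j c d} → Proper i j → ¬ i ∈I S → ¬ j ∈I S → (c , d) ∈ₚ S → i * j ∈₃ line c d
  ∉I⇒*∈line pij i∉ j∉ cd∈ with lines-meet (proper cd∈) pij
  ... | _ , x∈ , inj₁ refl = ⊥-elim (i∉ (_ , _ , cd∈ , x∈))
  ... | _ , x∈ , inj₂ (inj₁ refl) = ⊥-elim (j∉ (_ , _ , cd∈ , x∈))
  ... | _ , x∈ , inj₂ (inj₂ refl) = x∈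

  module _ {i j} (pij : Proper i j) where

    allOrNone⇒lines⊆ : AllOrNone (line i j) S → ∀ {c d} → (c , d) ∈ₚ S → line c d ⊆₃ line i j
    allOrNone⇒lines⊆ allOrNone cd∈ = allOrNone cd∈ (lines-meet (proper cd∈) pij)

    allOrNone⇔I≡line : NonEmpty S → AllOrNone (line i j) S ⇔ (∀ x → x ∈I S ⇔ x ∈₃ line i j)
    allOrNone⇔I≡line (a , b , ab∈) = mk⇔ I≡ij allOrNone-if-I≡ij
      where
      I≡ij : AllOrNone (line i j) S → ∀ x → x ∈I S ⇔ x ∈₃ line i j
      I≡ij allOrNone x = mk⇔
        (λ (_ , _ , cd∈ , x∈cd) → ∈₃-⊆₃ x∈cd (allOrNone⇒lines⊆ allOrNone cd∈))
        (λ x∈ij → a , b , ab∈ ,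
          ∈₃-⊆₃ x∈ij (⊆₃-pigeonhole (line-distinct (proper ab∈)) (allOrNone⇒lines⊆ allOrNone ab∈)))

      allOrNone-if-I≡ij : (∀ x → x ∈I S ⇔ x ∈₃ line i j) → AllOrNone (line i j) S
      allOrNone-if-I≡ij I≡ij {c} {d} cd∈ _ =
        in-ij c (inj₁ refl) , in-ij d (inj₂ (inj₁ refl)) , in-ij (c * d) (inj₂ (inj₂ refl))
        where
        in-ij : ∀ x → x ∈₃ line c d → x ∈₃ line i j
        in-ij x x∈cd = Equivalence.to (I≡ij x) (c , d , cd∈ , x∈cd)

  module _ (S-nice : GenNice S) where

    no-product-pairˡ : ∀ {a b} → (a , b) ∈ₚ S → ¬ (a * b , a) ∈ₚ S
    no-product-pairˡ {a} {b} ab∈ [ab]a∈ = let (_ , _ , aa∈ , _) = S-nice a b a ab∈ [ab]a∈ in irrefl aa∈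

    no-product-pairʳ : ∀ {a b} → (a , b) ∈ₚ S → ¬ (a * b , b) ∈ₚ S
    no-product-pairʳ {a} {b} ab∈ [ab]b∈ =
      no-product-pairˡ (∈ₚ-sym S ab∈) (∈ₚ-respˡ S (*-comm a b) [ab]b∈)

    pair-unique : ∀ {a b c d} → (a , b) ∈ₚ S → (c , d) ∈ₚ S → c ∈₃ line a b → d ∈₃ line a b →
                  (c ≡ a × d ≡ b) ⊎ (c ≡ b × d ≡ a)
    pair-unique _ _ (inj₁ refl) (inj₂ (inj₁ refl)) = inj₁ (refl , refl)
    pair-unique _ _ (inj₂ (inj₁ refl)) (inj₁ refl) = inj₂ (refl , refl)
    pair-unique _ cc∈ (inj₁ refl) (inj₁ refl) = ⊥-elim (irrefl cc∈)
    pair-unique _ cc∈ (inj₂ (inj₁ refl)) (inj₂ (inj₁ refl)) = ⊥-elim (irrefl cc∈)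
    pair-unique _ cc∈ (inj₂ (inj₂ refl)) (inj₂ (inj₂ refl)) = ⊥-elim (irrefl cc∈)
    pair-unique ab∈ cd∈ (inj₂ (inj₂ refl)) (inj₁ refl) = ⊥-elim (no-product-pairˡ ab∈ cd∈)
    pair-unique ab∈ cd∈ (inj₁ refl) (inj₂ (inj₂ refl)) = ⊥-elim (no-product-pairˡ ab∈ (∈ₚ-sym S cd∈))
    pair-unique ab∈ cd∈ (inj₂ (inj₂ refl)) (inj₂ (inj₁ refl)) = ⊥-elim (no-product-pairʳ ab∈ cd∈)
    pair-unique ab∈ cd∈ (inj₂ (inj₁ refl)) (inj₂ (inj₂ refl)) =
      ⊥-elim (no-product-pairʳ ab∈ (∈ₚ-sym S cd∈))

    concurrent⇒cardOne : ∀ {x y} → NonEmpty S → Proper x y →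
                            (∀ {c d} → (c , d) ∈ₚ S → x ∈₃ line c d × y ∈₃ line c d) → CardOne S
    concurrent⇒cardOne {x} {y} (a , b , ab∈) pxy through =
      a , b , λ c d → mk⇔ (λ cd∈ → let (c∈ , d∈ , _) = on-line cd∈ in pair-unique ab∈ cd∈ c∈ d∈) from
      where
      xy⊆ab : line x y ⊆₃ line a b
      xy⊆ab = ⊆₃-pigeonhole (line-distinct (proper ab∈))
                (line-spanned pxy (proj₁ (through ab∈)) (proj₂ (through ab∈)))

      on-line : ∀ {c d} → (c , d) ∈ₚ S → line c d ⊆₃ line a b
      on-line cd∈ = ⊆₃-trans (line-spanned pxy (proj₁ (through cd∈)) (proj₂ (through cd∈))) xy⊆ab

      from : ∀ {c d} → (c ≡ a × d ≡ b) ⊎ (c ≡ b × d ≡ a) → (c , d) ∈ₚ S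
      from (inj₁ (refl , refl)) = ab∈
      from (inj₂ (refl , refl)) = ∈ₚ-sym S ab∈

    module _ {i j k l : Pt} (i≢𝟘 : i ≢ 𝟘) (j≢𝟘 : j ≢ 𝟘) (k≢𝟘 : k ≢ 𝟘) (l≢𝟘 : l ≢ 𝟘) where

      private
        T : PairSet
        T = S ∪₄ ((i , i) , (j , j) , (k , k) , (l , l))

        D : Pt → Set
        D m = m ≡ i ⊎ m ≡ j ⊎ m ≡ k ⊎ m ≡ l

        D⇒≢𝟘 : ∀ {m} → D m → m ≢ 𝟘
        D⇒≢𝟘 (inj₁ refl) = i≢𝟘
        D⇒≢𝟘 (inj₂ (inj₁ refl)) = j≢𝟘
        D⇒≢𝟘 (inj₂ (inj₂ (inj₁ refl))) = k≢𝟘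
        D⇒≢𝟘 (inj₂ (inj₂ (inj₂ refl))) = l≢𝟘

        diagonal-pair : ∀ {m} → D m → (m , m) ∈ₚ T
        diagonal-pair (inj₁ refl) = inj₁ (inj₂ (inj₁ refl))
        diagonal-pair (inj₂ (inj₁ refl)) = inj₁ (inj₂ (inj₂ (inj₁ refl)))
        diagonal-pair (inj₂ (inj₂ (inj₁ refl))) = inj₁ (inj₂ (inj₂ (inj₂ (inj₁ refl))))
        diagonal-pair (inj₂ (inj₂ (inj₂ refl))) = inj₁ (inj₂ (inj₂ (inj₂ (inj₂ refl))))

        diagonal-view₁ : ∀ {x y} → T x y → S x y ⊎ (x ≡ y × D x)
        diagonal-view₁ (inj₁ s) = inj₁ s
        diagonal-view₁ (inj₂ (inj₁ refl)) = inj₂ (refl , inj₁ refl)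
        diagonal-view₁ (inj₂ (inj₂ (inj₁ refl))) = inj₂ (refl , inj₂ (inj₁ refl))
        diagonal-view₁ (inj₂ (inj₂ (inj₂ (inj₁ refl)))) = inj₂ (refl , inj₂ (inj₂ (inj₁ refl)))
        diagonal-view₁ (inj₂ (inj₂ (inj₂ (inj₂ refl)))) = inj₂ (refl , inj₂ (inj₂ (inj₂ refl)))

        diagonal-view : ∀ {x y} → (x , y) ∈ₚ T → (x , y) ∈ₚ S ⊎ (x ≡ y × D x)
        diagonal-view (inj₁ xy∈) with diagonal-view₁ xy∈
        ... | inj₁ s = inj₁ (inj₁ s)
        ... | inj₂ diag = inj₂ diag
        diagonal-view (inj₂ yx∈) with diagonal-view₁ yx∈
        ... | inj₁ s = inj₁ (inj₂ s)
        ... | inj₂ (refl , d) = inj₂ (refl , d)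

        nice⇒∉J : GenNice T → ∀ {m} → (m , m) ∈ₚ T → ¬ m ∈J S
        nice⇒∉J nice mm∈ (a , b , ab∈ , refl)
          with diagonal-view (proj₁ (proj₂ (proj₂ (nice a b (a * b) (∪₄-inj₁ S ab∈) mm∈))))
        ... | inj₁ [ab]a∈ = no-product-pairˡ ab∈ [ab]a∈
        ... | inj₂ (ab≡a , _) = proj₁ (proj₂ (proper ab∈)) (*≡ˡ⇒𝟘 ab≡a)

        ∉J⇒nice : (∀ {m} → D m → ¬ m ∈J S) → GenNice T
        ∉J⇒nice D∩J≡∅ x y z xy∈ [xy]z∈ with diagonal-view xy∈ | diagonal-view [xy]z∈
        ... | inj₁ s | inj₁ s′ = P⊆-mono S T (∪₄-inj₁ S) (S-nice x y z s s′)
        ... | inj₁ s | inj₂ (_ , d) = ⊥-elim (D∩J≡∅ d (x , y , s , refl))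
        ... | inj₂ (refl , _) | inj₁ s′ = ⊥-elim (proj₁ (proper s′) (*-selfInverse x))
        ... | inj₂ (refl , _) | inj₂ (_ , d) = ⊥-elim (D⇒≢𝟘 d (*-selfInverse x))

      diagonalExtension-nice⇔∉J :
        GenNice (S ∪₄ ((i , i) , (j , j) , (k , k) , (l , l)))
          ⇔ (¬ i ∈J S × ¬ j ∈J S × ¬ k ∈J S × ¬ l ∈J S)
      diagonalExtension-nice⇔∉J = mk⇔
        (λ nice → ∉J nice (inj₁ refl) , ∉J nice (inj₂ (inj₁ refl)) ,
                  ∉J nice (inj₂ (inj₂ (inj₁ refl))) , ∉J nice (inj₂ (inj₂ (inj₂ refl))))
        (λ (i∉ , j∉ , k∉ , l∉) → ∉J⇒nice λ
          { (inj₁ refl) → i∉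
          ; (inj₂ (inj₁ refl)) → j∉
          ; (inj₂ (inj₂ (inj₁ refl))) → k∉
          ; (inj₂ (inj₂ (inj₂ refl))) → l∉ })
        where
        ∉J : GenNice T → ∀ {m} → D m → ¬ m ∈J S
        ∉J nice = nice⇒∉J nice ∘ diagonal-pair

    module _ (p q r : Pt) where

      private
        T : PairSet
        T = S ∪₄ ((𝟘 , 𝟘) , (𝟘 , p) , (𝟘 , q) , (𝟘 , r))

        t : Triple
        t = p , q , r

        Z₀ : Pt → Set
        Z₀ y = y ≡ 𝟘 ⊎ y ∈₃ t

        zero-view₁ : ∀ {x y} → T x y → S x y ⊎ (x ≡ 𝟘 × Z₀ y)
        zero-view₁ (inj₁ s) = inj₁ s
        zero-view₁ (inj₂ (inj₁ refl)) = inj₂ (refl , inj₁ refl)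
        zero-view₁ (inj₂ (inj₂ (inj₁ refl))) = inj₂ (refl , inj₂ (inj₁ refl))
        zero-view₁ (inj₂ (inj₂ (inj₂ (inj₁ refl)))) = inj₂ (refl , inj₂ (inj₂ (inj₁ refl)))
        zero-view₁ (inj₂ (inj₂ (inj₂ (inj₂ refl)))) = inj₂ (refl , inj₂ (inj₂ (inj₂ refl)))

        zero-view : ∀ {x y} → (x , y) ∈ₚ T → (x , y) ∈ₚ S ⊎ (x ≡ 𝟘 × Z₀ y) ⊎ (y ≡ 𝟘 × Z₀ x)
        zero-view (inj₁ xy∈) with zero-view₁ xy∈
        ... | inj₁ s = inj₁ (inj₁ s)
        ... | inj₂ new = inj₂ (inj₁ new)
        zero-view (inj₂ yx∈) with zero-view₁ yx∈
        ... | inj₁ s = inj₁ (inj₂ s)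
        ... | inj₂ new = inj₂ (inj₂ new)

        zero-pair : ∀ {y} → Z₀ y → (𝟘 , y) ∈ₚ T
        zero-pair (inj₁ refl) = inj₁ (inj₂ (inj₁ refl))
        zero-pair (inj₂ (inj₁ refl)) = inj₁ (inj₂ (inj₂ (inj₁ refl)))
        zero-pair (inj₂ (inj₂ (inj₁ refl))) = inj₁ (inj₂ (inj₂ (inj₂ (inj₁ refl))))
        zero-pair (inj₂ (inj₂ (inj₂ refl))) = inj₁ (inj₂ (inj₂ (inj₂ (inj₂ refl))))

        zero-partner : ∀ {y} → (𝟘 , y) ∈ₚ T → y ≢ 𝟘 → y ∈₃ t
        zero-partner 𝟘y∈ y≢𝟘 with zero-view 𝟘y∈
        ... | inj₁ s = ⊥-elim (proj₁ (proper s) refl)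
        ... | inj₂ (inj₁ (_ , inj₁ y≡𝟘)) = ⊥-elim (y≢𝟘 y≡𝟘)
        ... | inj₂ (inj₁ (_ , inj₂ y∈)) = y∈
        ... | inj₂ (inj₂ (y≡𝟘 , _)) = ⊥-elim (y≢𝟘 y≡𝟘)

        module _ (nice : GenNice T) where

          first∈⇒line⊆ : ∀ {a b} → (a , b) ∈ₚ S → a ∈₃ t → line a b ⊆₃ t
          first∈⇒line⊆ {a} {b} ab∈ a∈ =
            let (_ , _ , b𝟘∈ , 𝟘[ab]∈ , _) =
                  nice 𝟘 a b (zero-pair (inj₂ a∈)) (∪₄-inj₁ S (∈ₚ-respˡ S (sym (*-identityˡ a)) ab∈))
                (_ , b≢𝟘 , a≢b) = proper ab∈
            in a∈ , zero-partner (∈ₚ-sym T b𝟘∈) b≢𝟘 , zero-partner 𝟘[ab]∈ (λ ab≡𝟘 → a≢b (*≡𝟘⇒≡ ab≡𝟘))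

          product∈⇒first∈ : ∀ {a b} → (a , b) ∈ₚ S → a * b ∈₃ t → a ∈₃ t
          product∈⇒first∈ {a} {b} ab∈ ab∈t =
            let (_ , _ , 𝟘a∈ , _) = nice a b 𝟘 (∪₄-inj₁ S ab∈) (∈ₚ-sym T (zero-pair (inj₂ ab∈t)))
            in zero-partner 𝟘a∈ (proj₁ (proper ab∈))

          nice⇒allOrNone : AllOrNone t S
          nice⇒allOrNone ab∈ (_ , inj₁ refl , a∈) = first∈⇒line⊆ ab∈ a∈
          nice⇒allOrNone ab∈ (_ , inj₂ (inj₁ refl) , b∈) =
            first∈⇒line⊆ ab∈ (proj₁ (proj₂ (first∈⇒line⊆ (∈ₚ-sym S ab∈) b∈)))
          nice⇒allOrNone ab∈ (_ , inj₂ (inj₂ refl) , ab∈t) = first∈⇒line⊆ ab∈ (product∈⇒first∈ ab∈ ab∈t)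

        P⊆-𝟘 : ∀ {y z} → Z₀ y → Z₀ z → Z₀ (y * z) → (y , z) ∈ₚ T → P⊆ 𝟘 y z T
        P⊆-𝟘 {y} {z} y₀ z₀ yz₀ yz∈ =
          zero-pair y₀ , yz∈ , ∈ₚ-sym T (zero-pair z₀) , zero-pair yz₀ ,
          ∈ₚ-respʳ T (sym (*-identityʳ z)) yz∈ , ∈ₚ-respʳ T (sym (*-identityˡ y)) (∈ₚ-sym T yz∈)

        module _ (allOrNone : AllOrNone t S) where

          from-pair : ∀ {x y z} → (x , y) ∈ₚ S → (x * y , z) ∈ₚ T → P⊆ x y z T
          from-pair {x} {y} {z} xy∈ [xy]z∈ with zero-view [xy]z∈
          ... | inj₁ s = P⊆-mono S T (∪₄-inj₁ S) (S-nice x y z xy∈ s)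
          ... | inj₂ (inj₁ (xy≡𝟘 , _)) = ⊥-elim (proj₂ (proj₂ (proper xy∈)) (*≡𝟘⇒≡ xy≡𝟘))
          ... | inj₂ (inj₂ (refl , inj₁ xy≡𝟘)) = ⊥-elim (proj₂ (proj₂ (proper xy∈)) (*≡𝟘⇒≡ xy≡𝟘))
          ... | inj₂ (inj₂ (refl , inj₂ xy∈t)) =
            let (x∈ , y∈ , _) = allOrNone xy∈ (x * y , inj₂ (inj₂ refl) , xy∈t)
            in P⊆-rotate T (P⊆-𝟘 (inj₂ x∈) (inj₂ y∈) (inj₂ xy∈t) (∪₄-inj₁ S xy∈))

          from-zero : ∀ {y z} → Z₀ y → (y , z) ∈ₚ T → P⊆ 𝟘 y z T
          from-zero {y} {z} y₀ yz∈ with zero-view yz∈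
          ... | inj₁ s with y₀
          ...   | inj₁ y≡𝟘 = ⊥-elim (proj₁ (proper s) y≡𝟘)
          ...   | inj₂ y∈ = let (_ , z∈ , yz∈t) = allOrNone s (y , inj₁ refl , y∈)
                            in P⊆-𝟘 y₀ (inj₂ z∈) (inj₂ yz∈t) yz∈
          from-zero {z = z} _ yz∈ | inj₂ (inj₁ (refl , z₀)) =
            P⊆-𝟘 (inj₁ refl) z₀ (subst Z₀ (sym (*-identityˡ z)) z₀) yz∈
          from-zero {y} y₀ yz∈ | inj₂ (inj₂ (refl , _)) =
            P⊆-𝟘 y₀ (inj₁ refl) (subst Z₀ (sym (*-identityʳ y)) y₀) yz∈

          allOrNone⇒nice : GenNice T
          allOrNone⇒nice x y z xy∈ [xy]z∈ with zero-view xy∈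
          ... | inj₁ s = from-pair s [xy]z∈
          ... | inj₂ (inj₁ (refl , y₀)) = from-zero y₀ (∈ₚ-respˡ T (*-identityˡ y) [xy]z∈)
          ... | inj₂ (inj₂ (refl , x₀)) = P⊆-swap T (from-zero x₀ (∈ₚ-respˡ T (*-identityʳ x) [xy]z∈))

      zeroExtension-nice⇔allOrNone :
        GenNice (S ∪₄ ((𝟘 , 𝟘) , (𝟘 , p) , (𝟘 , q) , (𝟘 , r))) ⇔ AllOrNone (p , q , r) S
      zeroExtension-nice⇔allOrNone = mk⇔ nice⇒allOrNone allOrNone⇒nice

    ∉I-generative⇒cardOne : ∀ {i j k} → NonEmpty S → Generative i j k →
                               (¬ i ∈I S × ¬ j ∈I S × ¬ k ∈I S) → CardOne S
    ∉I-generative⇒cardOne {i} ne (i≢𝟘 , j≢𝟘 , k≢𝟘 , i≢j , j≢k , i≢k , _) (i∉ , j∉ , k∉) =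
      concurrent⇒cardOne ne (i≢j ∘ *≡𝟘⇒≡ , i≢k ∘ *≡𝟘⇒≡ , j≢k ∘ *-cancelˡ i)
        λ cd∈ → ∉I⇒*∈line (i≢𝟘 , j≢𝟘 , i≢j) i∉ j∉ cd∈ , ∉I⇒*∈line (i≢𝟘 , k≢𝟘 , i≢k) i∉ k∉ cd∈

    allOrNone-line⇒cardOne : ∀ {i j} → NonEmpty S → Proper i j → AllOrNone (line i j) S → CardOne S
    allOrNone-line⇒cardOne ne pij allOrNone = concurrent⇒cardOne ne pij λ cd∈ →
      let (i∈ , j∈ , _) = ⊆₃-pigeonhole (line-distinct (proper cd∈)) (allOrNone⇒lines⊆ pij allOrNone cd∈)
      in i∈ , j∈

corollary6p8 : (S : PairSet) → ⊆X S → NonEmpty S → GenNice S →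
    ((i j k l : Pt) → InI i → InI j → InI k → InI l → Distinct4 i j k l →
      (GenNice (S ∪₄ ((i , i) , (j , j) , (k , k) , (l , l)))
        ⇔ (¬ i ∈J S × ¬ j ∈J S × ¬ k ∈J S × ¬ l ∈J S)))
    × ((i j k : Pt) → Generative i j k →
      (GenNice (S ∪₄ ((𝟘 , 𝟘) , (𝟘 , i) , (𝟘 , j) , (𝟘 , k)))
        ⇔ (¬ i ∈I S × ¬ j ∈I S × ¬ k ∈I S))
      × (GenNice (S ∪₄ ((𝟘 , 𝟘) , (𝟘 , i) , (𝟘 , j) , (𝟘 , k))) → CardOne S))
    × ((i j : Pt) → InI i → InI j → i ≢ j →
      (GenNice (S ∪₄ ((𝟘 , 𝟘) , (𝟘 , i) , (𝟘 , j) , (𝟘 , i * j)))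
        ⇔ (∀ x → x ∈I S ⇔ (x ≡ i ⊎ x ≡ j ⊎ x ≡ i * j)))
      × (GenNice (S ∪₄ ((𝟘 , 𝟘) , (𝟘 , i) , (𝟘 , j) , (𝟘 , i * j))) → CardOne S))
corollary6p8 S S⊆X nonEmpty S-nice =
    (λ i j k l i≢𝟘 j≢𝟘 k≢𝟘 l≢𝟘 _ → diagonalExtension-nice⇔∉J S⊆X S-nice i≢𝟘 j≢𝟘 k≢𝟘 l≢𝟘)
  , (λ i j k gen →
      let nice⇔∉I = ⇔.trans (zeroExtension-nice⇔allOrNone S⊆X S-nice i j k) (allOrNone⇔∉I S⊆X gen)
      in nice⇔∉I , ∉I-generative⇒cardOne S⊆X S-nice nonEmpty gen ∘ Equivalence.to nice⇔∉I)
  , (λ i j i≢𝟘 j≢𝟘 i≢j →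
      let nice⇔allOrNone = zeroExtension-nice⇔allOrNone S⊆X S-nice i j (i * j)
          pij = i≢𝟘 , j≢𝟘 , i≢j
      in ⇔.trans nice⇔allOrNone (allOrNone⇔I≡line S⊆X pij nonEmpty) ,
         allOrNone-line⇒cardOne S⊆X S-nice nonEmpty pij ∘ Equivalence.to nice⇔allOrNone)
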